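{- Let $\mathcal{A}=(Q,q_I,\delta,F)$ be a deterministic one-counter automaton that has an infinite run $(q_0,n_0)(q_1,n_1)(q_2,n_2)\cdots$. Then there are natural numbers $K_1,K_2,K_{inc}$ such that $K_1+K_2\le|Q|^3$, $K_{inc}\le|Q|$, and for every $i\ge K_1$, $(q_{i+K_2},n_{i+K_2})=(q_i,n_i+K_{inc})$.
   Context: A one-counter automaton is a tuple $\mathcal{A}=(Q,q_I,\delta,F)$ with $Q$ finite, $q_I\in Q$, $F\subseteq Q$, $\delta\subseteq Q\times\{\mathtt{inc},\mathtt{dec},\mathtt{ifzero}\}\times Q$. Configurations are $(q,n)\in Q\times\mathbb{N}$; $(q,n)\to(q',n')$ iff $(q,\mathtt{inc},q')\in\delta$ and $n'=n+1$, or $(q,\mathtt{dec},q')\in\delta$ and $n'=n-1\ge0$, or $(q,\mathtt{ifzero},q')\in\delta$ and $n=n'=0$. A run is a finite or infinite sequence of configurations starting at $(q_I,0)$ with consecutive ones related by $\to$. $\mathcal{A}$ is deterministic if for every state $q$: either exactly one transition leaves $q$ and it is labelled $\mathtt{inc}$, or exactly two leave $q$, one labelled $\mathtt{ifzero}$ and one $\mathtt{dec}$, or none leaves $q$ (so each configuration has at most one successor and there is at most one infinite run). -}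

module Defs where

open import Data.Nat using (ℕ; zero; suc; _+_)
open import Data.Fin using (Fin)
open import Data.Bool using (Bool; true; false)
open import Data.Product using (Σ; _×_; _,_)
open import Data.Sum using (_⊎_)
open import Relation.Binary.PropositionalEquality using (_≡_)

data Op : Set where
  inc dec ifzero : Op

-- A one-counter automaton with state set Q = Fin k (so |Q| = k).
-- The transition relation δ ⊆ Q × Op × Q is given by its (Boolean)
-- characteristic function; F ⊆ Q likewise.
record OCA (k : ℕ) : Set where
  field
    qI : Fin k
    δ  : Fin k → Op → Fin k → Bool
    F  : Fin k → Bool

Config : ℕ → Set
Config k = Fin k × ℕ

module _ {k : ℕ} (A : OCA k) where
  open OCA A

  data Step : Config k → Config k → Set where
    step-inc : ∀ {q q' n} → δ q inc q' ≡ true → Step (q , n) (q' , suc n)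
    step-dec : ∀ {q q' n} → δ q dec q' ≡ true → Step (q , suc n) (q' , n)
    step-zero : ∀ {q q'} → δ q ifzero q' ≡ true → Step (q , 0) (q' , 0)

  IncOnly : Fin k → Set
  IncOnly q = Σ (Fin k) λ q' → δ q inc q' ≡ true ×
    (∀ op q'' → δ q op q'' ≡ true → op ≡ inc × q'' ≡ q')

  ZeroDec : Fin k → Set
  ZeroDec q = Σ (Fin k) λ q₁ → Σ (Fin k) λ q₂ →
    δ q ifzero q₁ ≡ true × δ q dec q₂ ≡ true ×
    (∀ op q'' → δ q op q'' ≡ true → (op ≡ ifzero × q'' ≡ q₁) ⊎ (op ≡ dec × q'' ≡ q₂))

  NoneLeaves : Fin k → Set
  NoneLeaves q = ∀ op q'' → δ q op q'' ≡ false

  Deterministic : Set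
  Deterministic = ∀ q → IncOnly q ⊎ ZeroDec q ⊎ NoneLeaves q

  IsInfiniteRun : (ℕ → Config k) → Set
  IsInfiniteRun r = r 0 ≡ (qI , 0) × (∀ i → Step (r i) (r (suc i)))

-- By determinism the run is the unique orbit of a step function,
-- and shifting the counter by d commutes with every step except a zero test.
-- So once r j = r i + d with no zero test between i and j (or d = 0), the
-- segment from i to j repeats forever. Such i < j ≤ |Q|³ exist: if the
-- counter stays below |Q| up to time |Q|³, pigeonhole on the |Q|² such
-- configurations at |Q|³ + 1 times gives a repetition with d = 0; otherwise, once the
-- counter reaches |Q|, consider for each level v ≤ |Q| the last time it is
-- at v; two of these |Q| + 1 times share a state, and between them the
-- counter stays above the lower level, hence never meets a zero test.
module Submission where

open import Defs
open import Data.Nat using (ℕ; _+_; _≤_; _^_)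
open import Data.Product using (Σ; _×_; _,_; proj₁; proj₂; ∃-syntax)
open import Relation.Binary.PropositionalEquality using (_≡_)

open import Data.Bool using (true)
open import Data.Empty using (⊥-elim)
open import Data.Fin as Fin using (Fin; toℕ; fromℕ<; combine)
open import Data.Fin.Properties using (toℕ<n; toℕ-fromℕ<; any?; pigeonhole; combine-injective)
open import Data.Nat using (zero; suc; _*_; _∸_; _<_; z≤n; s≤s; s≤s⁻¹; _≟_; _≤?_; _<?_)
open import Data.Nat.Induction using (<-rec)
open import Data.Nat.Properties
open import Data.Sum using (inj₁; inj₂)
open import Relation.Binary.Definitions using (tri<; tri≈; tri>)
open import Relation.Binary.PropositionalEquality using (refl; sym; trans; cong; cong₂; subst; module ≡-Reasoning)
open import Relation.Nullary using (yes; no)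

module _ {k : ℕ} {A : OCA k} (det : Deterministic A) where
  open OCA A

  δ-functional : ∀ {q op a b} → δ q op a ≡ true → δ q op b ≡ true → a ≡ b
  δ-functional {q} {op} {a} {b} δa δb with det q
  ... | inj₁ (_ , _ , only) = trans (proj₂ (only op a δa)) (sym (proj₂ (only op b δb)))
  ... | inj₂ (inj₁ (_ , _ , _ , _ , only)) with only op a δa | only op b δb
  ...   | inj₁ (_ , a≡) | inj₁ (_ , b≡) = trans a≡ (sym b≡)
  ...   | inj₂ (_ , a≡) | inj₂ (_ , b≡) = trans a≡ (sym b≡)
  ...   | inj₁ (refl , _) | inj₂ (() , _)
  ...   | inj₂ (refl , _) | inj₁ (() , _)
  δ-functional {q} {op} {a} δa δb | inj₂ (inj₂ none) with trans (sym δa) (none op a)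
  ... | ()

  inc-exclusive : ∀ {q op a b} → δ q inc a ≡ true → δ q op b ≡ true → op ≡ inc
  inc-exclusive {q} {op} {a} {b} δa δb with det q
  ... | inj₁ (_ , _ , only) = proj₁ (only op b δb)
  ... | inj₂ (inj₁ (_ , _ , _ , _ , only)) with only inc a δa
  ...   | inj₁ (() , _)
  ...   | inj₂ (() , _)
  inc-exclusive {q} {a = a} δa δb | inj₂ (inj₂ none) with trans (sym δa) (none inc a)
  ... | ()

  step-functional : ∀ {c c₁ c₂} → Step A c c₁ → Step A c c₂ → c₁ ≡ c₂
  step-functional (step-inc δ₁) (step-inc δ₂) = cong (_, _) (δ-functional δ₁ δ₂)
  step-functional (step-dec δ₁) (step-dec δ₂) = cong (_, _) (δ-functional δ₁ δ₂)
  step-functional (step-zero δ₁) (step-zero δ₂) = cong (_, 0) (δ-functional δ₁ δ₂)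
  step-functional (step-inc δ₁) (step-dec δ₂) with () ← inc-exclusive δ₁ δ₂
  step-functional (step-inc δ₁) (step-zero δ₂) with () ← inc-exclusive δ₁ δ₂
  step-functional (step-dec δ₁) (step-inc δ₂) with () ← inc-exclusive δ₂ δ₁
  step-functional (step-zero δ₁) (step-inc δ₂) with () ← inc-exclusive δ₂ δ₁

shift : ∀ {k} → ℕ → Config k → Config k
shift d c = proj₁ c , proj₂ c + d

ZeroTest : ∀ {k} → Config k → Config k → Set
ZeroTest c c′ = proj₂ c ≡ 0 × proj₂ c′ ≡ 0

shift-step : ∀ {k} {A : OCA k} d {c c′} → Step A c c′ → (ZeroTest c c′ → d ≡ 0) →
             Step A (shift d c) (shift d c′)
shift-step d (step-inc δ) _ = step-inc δ
shift-step d (step-dec δ) _ = step-dec δ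
shift-step d (step-zero δ) no-test with refl ← no-test (refl , refl) = step-zero δ

step-counter-≤ : ∀ {k} {A : OCA k} {c c′} → Step A c c′ → proj₂ c′ ≤ suc (proj₂ c)
step-counter-≤ (step-inc _) = ≤-refl
step-counter-≤ (step-dec _) = m≤n⇒m≤1+n (n≤1+n _)
step-counter-≤ (step-zero _) = z≤n

last-visit : (f : ℕ → ℕ) → (∀ t → f (suc t) ≤ suc (f t)) →
             ∀ s v → f 0 ≤ v → v ≤ f s →
             ∃[ t ] t ≤ s × f t ≡ v × (∀ u → t < u → u ≤ s → v < f u)
last-visit f slow zero v f0≤v v≤f0 =
  0 , z≤n , ≤-antisym f0≤v v≤f0 , λ u 0<u u≤0 → ⊥-elim (<⇒≱ 0<u u≤0)
last-visit f slow (suc s) v f0≤v v≤fs with v ≟ f (suc s)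
... | yes v≡ = suc s , ≤-refl , sym v≡ , λ u s<u u≤s → ⊥-elim (<⇒≱ s<u u≤s)
... | no v≢ with last-visit f slow s v f0≤v (s≤s⁻¹ (≤-trans (≤∧≢⇒< v≤fs v≢) (slow s)))
...   | t , t≤s , ft≡v , above = t , m≤n⇒m≤1+n t≤s , ft≡v , above′
  where
    above′ : ∀ u → t < u → u ≤ suc s → v < f u
    above′ u t<u u≤1+s with m≤n⇒m<n∨m≡n u≤1+s
    ... | inj₁ u<1+s = above u t<u (s≤s⁻¹ u<1+s)
    ... | inj₂ refl = ≤∧≢⇒< v≤fs v≢

square≤cube : ∀ m → m * m ≤ m ^ 3
square≤cube zero = z≤n
square≤cube (suc m) = *-monoʳ-≤ (suc m) (m≤m*n (suc m) (suc m * 1))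

module _ {k : ℕ} {A : OCA k} (det : Deterministic A)
         (r : ℕ → Config k) (run : IsInfiniteRun A r) where

  counter : ℕ → ℕ
  counter t = proj₂ (r t)

  counter-start : counter 0 ≡ 0
  counter-start = cong proj₂ (proj₁ run)

  counter-slow : ∀ t → counter (suc t) ≤ suc (counter t)
  counter-slow t = step-counter-≤ (proj₂ run t)

  shifted-run-step : ∀ {t p d} → r (t + p) ≡ shift d (r t) →
                     (ZeroTest (r t) (r (suc t)) → d ≡ 0) →
                     r (suc t + p) ≡ shift d (r (suc t))
  shifted-run-step {t} {p} {d} shifted no-test =
    step-functional det (proj₂ run (t + p))
      (subst (λ c → Step A c (shift d (r (suc t)))) (sym shifted) (shift-step d (proj₂ run t) no-test))

  -- Beyond the first period, the counter is at least d, so only d = 0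
  -- allows a zero test there; strong induction supplies that earlier period.
  periodic-from : ∀ {i p d} → 0 < p → r (i + p) ≡ shift d (r i) →
                  (∀ s → s < p → ZeroTest (r (i + s)) (r (suc (i + s))) → d ≡ 0) →
                  ∀ t → i ≤ t → r (t + p) ≡ shift d (r t)
  periodic-from {i} {p} {d} p-pos base no-test t i≤t =
    subst (λ x → r (x + p) ≡ shift d (r x)) (m+[n∸m]≡n i≤t) (<-rec Periodic periodic (t ∸ i))
    where
      Periodic : ℕ → Set
      Periodic s = r (i + s + p) ≡ shift d (r (i + s))

      no-test-at : ∀ s → (∀ {s′} → s′ < s → Periodic s′) →
                   ZeroTest (r (i + s)) (r (suc (i + s))) → d ≡ 0
      no-test-at s earlier test with s <? p
      ... | yes s<p = no-test s s<p test
      ... | no s≮p = m+n≡0⇒n≡0 (counter (i + (s ∸ p))) (begin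
            counter (i + (s ∸ p)) + d   ≡⟨ cong proj₂ (earlier (∸-monoʳ-< {o = 0} p-pos p≤s)) ⟨
            counter (i + (s ∸ p) + p)   ≡⟨ cong counter i+[s∸p]+p≡i+s ⟩
            counter (i + s)             ≡⟨ proj₁ test ⟩
            0                           ∎)
        where
          open ≡-Reasoning
          p≤s : p ≤ s
          p≤s = ≮⇒≥ s≮p
          i+[s∸p]+p≡i+s : i + (s ∸ p) + p ≡ i + s
          i+[s∸p]+p≡i+s = trans (+-assoc i (s ∸ p) p) (cong (i +_) (m∸n+n≡m p≤s))

      periodic : ∀ s → (∀ {s′} → s′ < s → Periodic s′) → Periodic s
      periodic zero _ = subst (λ x → r (x + p) ≡ shift d (r x)) (sym (+-identityʳ i)) base
      periodic (suc s) earlier =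
        subst (λ x → r (x + p) ≡ shift d (r x)) (sym (+-suc i s))
          (shifted-run-step (earlier ≤-refl) (no-test-at s (λ s′<s → earlier (m<n⇒m<1+n s′<s))))

  EventuallyPeriodic : Set
  EventuallyPeriodic = Σ ℕ λ K₁ → Σ ℕ λ K₂ → Σ ℕ λ Kinc →
    K₁ + K₂ ≤ k ^ 3 × 1 ≤ K₂ × Kinc ≤ k ×
    (∀ i → K₁ ≤ i → r (i + K₂) ≡ (proj₁ (r i) , proj₂ (r i) + Kinc))

  periodic-from-repeat : ∀ {i j d} → i < j → j ≤ k ^ 3 → d ≤ k → r j ≡ shift d (r i) →
                         (∀ s → s < j ∸ i → ZeroTest (r (i + s)) (r (suc (i + s))) → d ≡ 0) →
                         EventuallyPeriodic
  periodic-from-repeat {i} {j} {d} i<j j≤k³ d≤k repeat no-test =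
    i , j ∸ i , d , subst (_≤ k ^ 3) (sym i+[j∸i]≡j) j≤k³ , m<n⇒0<n∸m i<j , d≤k ,
    periodic-from (m<n⇒0<n∸m i<j) (trans (cong r i+[j∸i]≡j) repeat) no-test
    where
      i+[j∸i]≡j : i + (j ∸ i) ≡ j
      i+[j∸i]≡j = m+[n∸m]≡n (<⇒≤ i<j)

  periodic-if-counter-low : (∀ (t : Fin (suc (k ^ 3))) → counter (toℕ t) < k) → EventuallyPeriodic
  periodic-if-counter-low low = from-collision (pigeonhole (s≤s (square≤cube k)) code)
    where
      level : Fin (suc (k ^ 3)) → Fin k
      level t = fromℕ< (low t)

      code : Fin (suc (k ^ 3)) → Fin (k * k)
      code t = combine (proj₁ (r (toℕ t))) (level t)

      from-collision : ∃[ a ] ∃[ b ] a Fin.< b × code a ≡ code b → EventuallyPeriodic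
      from-collision (a , b , a<b , code≡)
        with state≡ , level≡ ← combine-injective _ (level a) _ (level b) code≡ =
        periodic-from-repeat a<b (s≤s⁻¹ (toℕ<n b)) z≤n
          (cong₂ _,_ (sym state≡) (sym (trans (+-identityʳ _) counter≡))) (λ _ _ _ → refl)
        where
          counter≡ : counter (toℕ a) ≡ counter (toℕ b)
          counter≡ = trans (sym (toℕ-fromℕ< _)) (trans (cong toℕ level≡) (toℕ-fromℕ< _))

  LastVisit : ℕ → ℕ → Set
  LastVisit s v = ∃[ t ] t ≤ s × counter t ≡ v × (∀ u → t < u → u ≤ s → v < counter u)

  periodic-from-last-visits : ∀ {s a b} → s ≤ k ^ 3 → a < b → b ≤ k →
                              (v₁ : LastVisit s a) (v₂ : LastVisit s b) →
                              proj₁ (r (proj₁ v₁)) ≡ proj₁ (r (proj₁ v₂)) → EventuallyPeriodic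
  periodic-from-last-visits {s} {a} {b} s≤k³ a<b b≤k
      (t₁ , t₁≤s , at-a , above-a) (t₂ , t₂≤s , at-b , above-b) state≡ =
    periodic-from-repeat t₁<t₂ (≤-trans t₂≤s s≤k³) (≤-trans (m∸n≤m b a) b≤k)
      (cong₂ _,_ (sym state≡) counter≡) no-test
    where
      t₁<t₂ : t₁ < t₂
      t₁<t₂ with <-cmp t₁ t₂
      ... | tri< t₁<t₂ _ _ = t₁<t₂
      ... | tri≈ _ refl _ = ⊥-elim (<-irrefl (trans (sym at-a) at-b) a<b)
      ... | tri> _ _ t₂<t₁ = ⊥-elim (<-asym a<b (subst (b <_) at-a (above-b t₁ t₂<t₁ t₁≤s)))

      counter≡ : counter t₂ ≡ counter t₁ + (b ∸ a)
      counter≡ = begin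
        counter t₂            ≡⟨ at-b ⟩
        b                     ≡⟨ m+[n∸m]≡n (<⇒≤ a<b) ⟨
        a + (b ∸ a)           ≡⟨ cong (_+ (b ∸ a)) at-a ⟨
        counter t₁ + (b ∸ a)  ∎
        where open ≡-Reasoning

      no-test : ∀ s′ → s′ < t₂ ∸ t₁ → ZeroTest (r (t₁ + s′)) (r (suc (t₁ + s′))) → b ∸ a ≡ 0
      no-test s′ s′<p (_ , zero-after) = ⊥-elim (n≮0 (subst (a <_) zero-after above))
        where
          within : suc (t₁ + s′) ≤ t₂
          within = subst (suc (t₁ + s′) ≤_) (m+[n∸m]≡n (<⇒≤ t₁<t₂)) (+-monoʳ-< t₁ s′<p)

          above : a < counter (suc (t₁ + s′))
          above = above-a (suc (t₁ + s′)) (s≤s (m≤m+n t₁ s′)) (≤-trans within t₂≤s)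

  periodic-if-counter-high : (s : Fin (suc (k ^ 3))) → k ≤ counter (toℕ s) → EventuallyPeriodic
  periodic-if-counter-high s k≤counter = from-collision (pigeonhole (n<1+n k) state-at-visit)
    where
      visit : (v : Fin (suc k)) → LastVisit (toℕ s) (toℕ v)
      visit v = last-visit counter counter-slow (toℕ s) (toℕ v)
                  (subst (_≤ toℕ v) (sym counter-start) z≤n)
                  (≤-trans (s≤s⁻¹ (toℕ<n v)) k≤counter)

      state-at-visit : Fin (suc k) → Fin k
      state-at-visit v = proj₁ (r (proj₁ (visit v)))

      from-collision : ∃[ a ] ∃[ b ] a Fin.< b × state-at-visit a ≡ state-at-visit b → EventuallyPeriodic
      from-collision (a , b , a<b , state≡) =
        periodic-from-last-visits (s≤s⁻¹ (toℕ<n s)) a<b (s≤s⁻¹ (toℕ<n b)) (visit a) (visit b) state≡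

lemma4 : (k : ℕ) (A : OCA k) → Deterministic A →
    (r : ℕ → Config k) → IsInfiniteRun A r →
    Σ ℕ λ K₁ → Σ ℕ λ K₂ → Σ ℕ λ Kinc →
    K₁ + K₂ ≤ k ^ 3 × 1 ≤ K₂ × Kinc ≤ k ×
    (∀ i → K₁ ≤ i → r (i + K₂) ≡ (proj₁ (r i) , proj₂ (r i) + Kinc))
lemma4 k A det r run with any? (λ t → k ≤? counter det r run (toℕ t))
... | yes (t , k≤counter) = periodic-if-counter-high det r run t k≤counter
... | no never-high =
  periodic-if-counter-low det r run (λ t → ≰⇒> (λ k≤counter → never-high (t , k≤counter)))
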